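{- Let $\lambda\subseteq\mu\subseteq\sigma_n$ be partitions such that $\mu/\lambda$ is a vertical $n$-strip, and let $\tilde\mu=(n,\mu_1-1,\dots,\mu_n-1)$. Then $\tilde\mu/\lambda$ is a horizontal $n$-strip (in particular $\lambda\subseteq\tilde\mu$) with $|\tilde\mu/\lambda|=|\mu/\lambda|$. Moreover, the skew shape $\sigma_n/\tilde\mu$ is obtained by shifting the skew shape $\sigma_n/\mu$ down one unit and left one unit.
   Context: Partitions are Young diagrams in English notation (rows indexed from the top, columns from the left), with $\mu_i=0$ for $i$ beyond the length of $\mu$; $\sigma_n=(n,n-1,\dots,1)$. For $\lambda\subseteq\mu\subseteq\sigma_n$, $\mu/\lambda$ is a vertical $n$-strip if $\mu$ has length $n$, $|\mu/\lambda|$ is $n$ or $n-1$, and $\mu_i-1\le\lambda_i$ for all $i$. For partitions $\lambda\subseteq\nu\subseteq\sigma_n$, $\nu/\lambda$ is a horizontal $n$-strip if $\nu_1=n$, $|\nu/\lambda|$ is $n$ or $n-1$, and $\nu_{i+1}\le\lambda_i$ for all $i$. -}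

module Defs where

open import Data.Nat using (ℕ; zero; suc; _+_; _∸_; _≤_; _<_)
open import Data.Product using (_×_; ∃)
open import Data.Sum using (_⊎_)
open import Relation.Binary.PropositionalEquality using (_≡_)

-- A partition is encoded by its sequence of parts p 0 ≥ p 1 ≥ … (row i of the
-- Young diagram, rows indexed from 0 at the top), eventually zero.
Part : Set
Part = ℕ → ℕ

IsPartition : Part → Set
IsPartition p = (∀ i → p (suc i) ≤ p i) × ∃ (λ N → ∀ i → N ≤ i → p i ≡ 0)

_⊆ₚ_ : Part → Part → Set
l ⊆ₚ m = ∀ i → l i ≤ m i

σ : ℕ → Part
σ n i = n ∸ i

HasLength : Part → ℕ → Set
HasLength m n = (∀ i → i < n → 0 < m i) × (∀ i → n ≤ i → m i ≡ 0)

sumBelow : ℕ → (ℕ → ℕ) → ℕ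
sumBelow zero    f = 0
sumBelow (suc k) f = sumBelow k f + f k

-- |ν/λ| for λ ⊆ ν ⊆ σ_n (all rows ≥ n of such ν are empty, so summing rows < n suffices)
skewSize : ℕ → Part → Part → ℕ
skewSize n ν l = sumBelow n (λ i → ν i ∸ l i)

-- μ/λ is a vertical n-strip (λ ⊆ μ ⊆ σ_n assumed separately)
VerticalStrip : ℕ → Part → Part → Set
VerticalStrip n l m =
  HasLength m n
  × (skewSize n m l ≡ n ⊎ skewSize n m l ≡ n ∸ 1)
  × (∀ i → m i ∸ 1 ≤ l i)

-- ν/λ is a horizontal n-strip (λ ⊆ ν ⊆ σ_n assumed separately)
HorizontalStrip : ℕ → Part → Part → Set
HorizontalStrip n l ν =
  ν 0 ≡ n
  × (skewSize n ν l ≡ n ⊎ skewSize n ν l ≡ n ∸ 1)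
  × (∀ i → ν (suc i) ≤ l i)

tilde : ℕ → Part → Part
tilde n m zero    = n
tilde n m (suc i) = m i ∸ 1

InSkew : Part → Part → ℕ → ℕ → Set
InSkew ν l i j = l i ≤ j × j < ν i

module Submission where

open import Defs
open import Data.Nat using (ℕ; suc)
open import Data.Product using (_×_; ∃; ∃₂)
open import Function.Bundles using (_⇔_)
open import Relation.Binary.PropositionalEquality using (_≡_)

open import Data.Nat using (zero; _+_; _*_; _∸_; _≤_; _<_; z≤n; s≤s; s≤s⁻¹; _≤?_; _<?_)
open import Data.Nat.Properties
open import Data.Product using (_,_)
open import Data.Sum using (_⊎_; inj₁; inj₂)
open import Data.Empty using (⊥-elim)
open import Relation.Nullary using (yes; no)
open import Relation.Binary.PropositionalEquality using (refl; sym; trans; cong; cong₂; subst; module ≡-Reasoning)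
open import Function.Bundles using (mk⇔; module Equivalence)
open import Algebra.Properties.CommutativeSemigroup +-commutativeSemigroup using (interchange)

-- The vertical-strip condition μᵢ − 1 ≤ λᵢ says that every row of
-- μ/λ has at most one cell, and the size condition (n or n − 1 cells in n rows)
-- says that at most one of the rows 0, …, n−1 is empty.  If λᵢ₊₁ > μᵢ − 1 for
-- some i + 1 < n, then μᵢ ≤ λᵢ₊₁ ≤ λᵢ ≤ μᵢ and μᵢ₊₁ ≤ μᵢ ≤ λᵢ₊₁, so rows i and
-- i + 1 would both be empty; hence λ ⊆ μ̃, and λᵢ₊₁ ≥ μᵢ − 1 = μ̃ᵢ₊₁ is exactly
-- the horizontal-strip condition.  Since μ ⊆ σₙ has length n, its last row is
-- μₙ₋₁ = 1, so |μ̃| = n + Σ_{i<n−1} (μᵢ − 1) = |μ|, whence |μ̃/λ| = |μ/λ|.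
-- Finally μ̃ᵢ₊₁ = μᵢ − 1 and (σₙ)ᵢ₊₁ = (σₙ)ᵢ − 1, which is the shift of the
-- skew shape σₙ/μ by one row down and one column left.

∸1≤⇔≤suc : ∀ a j → (a ∸ 1 ≤ j) ⇔ (a ≤ suc j)
∸1≤⇔≤suc zero    j = mk⇔ (λ _ → z≤n) (λ _ → z≤n)
∸1≤⇔≤suc (suc a) j = mk⇔ s≤s s≤s⁻¹

<∸1⇔suc< : ∀ j x → (j < x ∸ 1) ⇔ (suc j < x)
<∸1⇔suc< j zero    = mk⇔ (λ ()) (λ ())
<∸1⇔suc< j (suc x) = mk⇔ s≤s s≤s⁻¹

∸1<⇒≤ : ∀ a x → a ∸ 1 < x → a ≤ x
∸1<⇒≤ zero    x _ = z≤n
∸1<⇒≤ (suc a) x p = p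

∸-suc : ∀ n i → n ∸ suc i ≡ n ∸ i ∸ 1
∸-suc n       zero    = refl
∸-suc zero    (suc i) = refl
∸-suc (suc n) (suc i) = ∸-suc n i

≡⊎≡∸1⇒≤suc : ∀ {s n} → s ≡ n ⊎ s ≡ n ∸ 1 → n ≤ suc s
≡⊎≡∸1⇒≤suc (inj₁ refl)       = n≤1+n _
≡⊎≡∸1⇒≤suc {n = n} (inj₂ refl) = m≤n+m∸n n 1

sumBelow-suc : ∀ k (f : ℕ → ℕ) → sumBelow (suc k) f ≡ f 0 + sumBelow k (λ i → f (suc i))
sumBelow-suc zero    f = sym (+-identityʳ (f 0))
sumBelow-suc (suc k) f rewrite sumBelow-suc k f = +-assoc (f 0) _ _

sumBelow-∸ : ∀ k (f g : ℕ → ℕ) → (∀ i → i < k → g i ≤ f i) →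
  sumBelow k (λ i → f i ∸ g i) + sumBelow k g ≡ sumBelow k f
sumBelow-∸ zero    f g g≤f = refl
sumBelow-∸ (suc k) f g g≤f = trans
  (interchange (sumBelow k (λ i → f i ∸ g i)) (f k ∸ g k) (sumBelow k g) (g k))
  (cong₂ _+_ (sumBelow-∸ k f g (λ i i<k → g≤f i (m<n⇒m<1+n i<k))) (m∸n+n≡m (g≤f k (n<1+n k))))

sumBelow-const : ∀ k c → sumBelow k (λ _ → c) ≡ k * c
sumBelow-const zero    c = refl
sumBelow-const (suc k) c = trans (cong (_+ c) (sumBelow-const k c)) (+-comm (k * c) c)

sumBelow-≤1 : ∀ k (f : ℕ → ℕ) → (∀ i → f i ≤ 1) → sumBelow k f ≤ k
sumBelow-≤1 zero    f f≤1 = z≤n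
sumBelow-≤1 (suc k) f f≤1 =
  subst (sumBelow (suc k) f ≤_) (+-comm k 1) (+-mono-≤ (sumBelow-≤1 k f f≤1) (f≤1 k))

sumBelow-≤1-zero : ∀ k (f : ℕ → ℕ) → (∀ i → f i ≤ 1) →
  ∀ {a} → a < k → f a ≡ 0 → suc (sumBelow k f) ≤ k
sumBelow-≤1-zero (suc k) f f≤1 {a} (s≤s a≤k) fa≡0 with m≤n⇒m<n∨m≡n a≤k
... | inj₁ a<k = begin
  suc (sumBelow k f + f k) ≤⟨ s≤s (+-monoʳ-≤ (sumBelow k f) (f≤1 k)) ⟩
  suc (sumBelow k f + 1)   ≡⟨ cong suc (+-comm (sumBelow k f) 1) ⟩
  suc (suc (sumBelow k f)) ≤⟨ s≤s (sumBelow-≤1-zero k f f≤1 a<k fa≡0) ⟩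
  suc k                    ∎
  where open ≤-Reasoning
... | inj₂ refl rewrite fa≡0 | +-identityʳ (sumBelow a f) = s≤s (sumBelow-≤1 a f f≤1)

sumBelow-≤1-zeros : ∀ k (f : ℕ → ℕ) → (∀ i → f i ≤ 1) →
  ∀ {a b} → a < b → b < k → f a ≡ 0 → f b ≡ 0 → 2 + sumBelow k f ≤ k
sumBelow-≤1-zeros (suc k) f f≤1 {a} {b} a<b (s≤s b≤k) fa≡0 fb≡0 with m≤n⇒m<n∨m≡n b≤k
... | inj₁ b<k = begin
  2 + (sumBelow k f + f k) ≤⟨ +-monoʳ-≤ 2 (+-monoʳ-≤ (sumBelow k f) (f≤1 k)) ⟩
  2 + (sumBelow k f + 1)   ≡⟨ cong (2 +_) (+-comm (sumBelow k f) 1) ⟩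
  suc (2 + sumBelow k f)   ≤⟨ s≤s (sumBelow-≤1-zeros k f f≤1 a<b b<k fa≡0 fb≡0) ⟩
  suc k                    ∎
  where open ≤-Reasoning
... | inj₂ refl rewrite fb≡0 | +-identityʳ (sumBelow b f) = s≤s (sumBelow-≤1-zero b f f≤1 a<b fa≡0)

skewSize-≡ : ∀ n {l ν μ} → l ⊆ₚ ν → l ⊆ₚ μ → sumBelow n ν ≡ sumBelow n μ →
  skewSize n ν l ≡ skewSize n μ l
skewSize-≡ n {l} {ν} {μ} l⊆ν l⊆μ |ν|≡|μ| = +-cancelʳ-≡ (sumBelow n l) _ _ (begin
  skewSize n ν l + sumBelow n l ≡⟨ sumBelow-∸ n ν l (λ i _ → l⊆ν i) ⟩
  sumBelow n ν                  ≡⟨ |ν|≡|μ| ⟩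
  sumBelow n μ                  ≡⟨ sumBelow-∸ n μ l (λ i _ → l⊆μ i) ⟨
  skewSize n μ l + sumBelow n l ∎)
  where open ≡-Reasoning

tilde-isPartition : ∀ n m → IsPartition m → m 0 ≤ n → IsPartition (tilde n m)
tilde-isPartition n m (antitone , N , vanish) m₀≤n = antitone′ , suc N , vanish′
  where
  antitone′ : ∀ i → tilde n m (suc i) ≤ tilde n m i
  antitone′ zero    = ≤-trans (m∸n≤m (m 0) 1) m₀≤n
  antitone′ (suc i) = ∸-monoˡ-≤ 1 (antitone i)

  vanish′ : ∀ i → suc N ≤ i → tilde n m i ≡ 0
  vanish′ (suc i) (s≤s N≤i) = cong (_∸ 1) (vanish i N≤i)

tilde⊆σ : ∀ n m → m ⊆ₚ σ n → tilde n m ⊆ₚ σ n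
tilde⊆σ n m m⊆σ zero    = ≤-refl
tilde⊆σ n m m⊆σ (suc i) = subst (m i ∸ 1 ≤_) (sym (∸-suc n i)) (∸-monoˡ-≤ 1 (m⊆σ i))

sumBelow-tilde : ∀ n m → HasLength m n → m ⊆ₚ σ n → sumBelow n (tilde n m) ≡ sumBelow n m
sumBelow-tilde zero    m _          _   = refl
sumBelow-tilde (suc k) m (pos , _) m⊆σ = begin
  sumBelow (suc k) (tilde (suc k) m) ≡⟨ sumBelow-suc k (tilde (suc k) m) ⟩
  suc k + s                          ≡⟨ cong suc (+-comm k s) ⟩
  suc (s + k)                        ≡⟨ cong suc sumBelow-∸1   ⟩
  suc (sumBelow k m)                 ≡⟨ +-comm 1 (sumBelow k m) ⟩
  sumBelow k m + 1                   ≡⟨ cong (sumBelow k m +_) last-row ⟨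
  sumBelow k m + m k                 ∎
  where
  open ≡-Reasoning
  s : ℕ
  s = sumBelow k (λ i → m i ∸ 1)

  last-row : m k ≡ 1
  last-row = ≤-antisym (subst (m k ≤_) (m+n∸n≡m 1 k) (m⊆σ k)) (pos k (n<1+n k))

  sumBelow-∸1 : s + k ≡ sumBelow k m
  sumBelow-∸1 = begin
    s + k                        ≡⟨ cong (s +_) (*-identityʳ k) ⟨
    s + k * 1                    ≡⟨ cong (s +_) (sumBelow-const k 1) ⟨
    s + sumBelow k (λ _ → 1)     ≡⟨ sumBelow-∸ k m (λ _ → 1) (λ i i<k → pos i (m<n⇒m<1+n i<k)) ⟩
    sumBelow k m                 ∎

vertical-strip-rows≤1 : ∀ {l m : Part} → (∀ i → m i ∸ 1 ≤ l i) → ∀ i → m i ∸ l i ≤ 1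
vertical-strip-rows≤1 {l} {m} strip i =
  m≤n+o⇒m∸n≤o (m i) (l i) (subst (m i ≤_) (+-comm 1 (l i)) (Equivalence.to (∸1≤⇔≤suc (m i) (l i)) (strip i)))

vertical-strip-⊆tilde : ∀ n {l m} → IsPartition l → IsPartition m → l ⊆ₚ m → m ⊆ₚ σ n →
  VerticalStrip n l m → l ⊆ₚ tilde n m
vertical-strip-⊆tilde n _ _ l⊆m m⊆σ _ zero = ≤-trans (l⊆m 0) (m⊆σ 0)
vertical-strip-⊆tilde n {l} {m} (l-antitone , _) (m-antitone , _) l⊆m _ ((_ , vanish) , size , strip) (suc i)
  with suc i <? n
... | no  i+1≮n = subst (_≤ m i ∸ 1) (sym lᵢ₊₁≡0) z≤n
  where
  lᵢ₊₁≡0 : l (suc i) ≡ 0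
  lᵢ₊₁≡0 = n≤0⇒n≡0 (≤-trans (l⊆m (suc i)) (≤-reflexive (vanish (suc i) (≮⇒≥ i+1≮n))))
... | yes i+1<n with l (suc i) ≤? m i ∸ 1
...   | yes l≤μ̃ = l≤μ̃
...   | no  l≰μ̃ = ⊥-elim (1+n≰n (≤-trans two-empty-rows (≡⊎≡∸1⇒≤suc size)))
  where
  mᵢ≤lᵢ₊₁ : m i ≤ l (suc i)
  mᵢ≤lᵢ₊₁ = ∸1<⇒≤ (m i) (l (suc i)) (≰⇒> l≰μ̃)

  two-empty-rows : 2 + skewSize n m l ≤ n
  two-empty-rows = sumBelow-≤1-zeros n (λ k → m k ∸ l k) (vertical-strip-rows≤1 strip) (n<1+n i) i+1<n
    (m≤n⇒m∸n≡0 (≤-trans mᵢ≤lᵢ₊₁ (l-antitone i)))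
    (m≤n⇒m∸n≡0 (≤-trans (m-antitone i) mᵢ≤lᵢ₊₁))

tilde-shift : ∀ n m i j → InSkew (σ n) (tilde n m) i j
  ⇔ ∃₂ (λ i′ j′ → InSkew (σ n) m i′ j′ × i ≡ suc i′ × suc j ≡ j′)
tilde-shift n m zero    j = mk⇔ (λ (n≤j , j<n) → ⊥-elim (1+n≰n (≤-trans j<n n≤j))) (λ { (_ , _ , _ , () , _) })
tilde-shift n m (suc i) j = mk⇔
  (λ (μ̃≤j , j<σ) → i , suc j , (to (∸1≤⇔≤suc (m i) j) μ̃≤j , to (<∸1⇔suc< j (n ∸ i)) (subst (j <_) (∸-suc n i) j<σ)) , refl , refl)
  (λ { (_ , _ , (μ≤j+1 , j+1<σ) , refl , refl) →
       from (∸1≤⇔≤suc (m i) j) μ≤j+1 , subst (j <_) (sym (∸-suc n i)) (from (<∸1⇔suc< j (n ∸ i)) j+1<σ) })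
  where open Equivalence

lemma3p7 : (n : ℕ) (l m : Part) →
    IsPartition l → IsPartition m → l ⊆ₚ m → m ⊆ₚ σ n →
    VerticalStrip n l m →
    IsPartition (tilde n m) × l ⊆ₚ tilde n m × tilde n m ⊆ₚ σ n
    × HorizontalStrip n l (tilde n m)
    × skewSize n (tilde n m) l ≡ skewSize n m l
    × (∀ i j → InSkew (σ n) (tilde n m) i j
    ⇔ ∃₂ (λ i′ j′ → InSkew (σ n) m i′ j′ × i ≡ suc i′ × suc j ≡ j′))
lemma3p7 n l m l-part m-part l⊆m m⊆σ vs@(length , size , strip) =
  tilde-isPartition n m m-part (m⊆σ 0) , l⊆μ̃ , tilde⊆σ n m m⊆σ ,
  (refl , subst (λ s → s ≡ n ⊎ s ≡ n ∸ 1) (sym |μ̃/λ|≡|μ/λ|) size , strip) ,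
  |μ̃/λ|≡|μ/λ| , tilde-shift n m
  where
  l⊆μ̃ : l ⊆ₚ tilde n m
  l⊆μ̃ = vertical-strip-⊆tilde n l-part m-part l⊆m m⊆σ vs

  |μ̃/λ|≡|μ/λ| : skewSize n (tilde n m) l ≡ skewSize n m l
  |μ̃/λ|≡|μ/λ| = skewSize-≡ n l⊆μ̃ l⊆m (sumBelow-tilde n m length m⊆σ)
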